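{- Let $N,m,k\in\mathbb{N}$ with $\gcd(Nk,m)=1$. Then \[ \mathcal{L}_{N,m,k}\subseteq\{x\in\mathbb{Z}/m\mathbb{Z}: x^2-4kN \text{ is a square modulo } m\}. \] If $m$ is odd, the two sets are equal.
   Context: $\mathcal{H}_{N,m}:=\{(x,y)\in(\mathbb{Z}/m\mathbb{Z})^2: xy\equiv N \bmod m\}$ and $\mathcal{L}_{N,m,k}:=\{kx+y\bmod m:(x,y)\in\mathcal{H}_{N,m}\}$. An element $z$ is a square modulo $m$ if $z\equiv y^2\bmod m$ for some integer $y$. -}

module Defs where

open import Data.Nat using (ℕ)
open import Data.Integer using (ℤ; +_; _+_; _-_; _*_)
open import Data.Integer.Divisibility using (_∣_)
open import Data.Product using (∃; ∃-syntax; _×_)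

-- Congruence modulo m on integers: residue classes of ℤ/mℤ are represented
-- by integers, and equality in ℤ/mℤ is this congruence.
_≡_[mod_] : ℤ → ℤ → ℕ → Set
x ≡ y [mod m ] = (+ m) ∣ (x - y)

infix 4 _≡_[mod_]

InH : ℕ → ℕ → ℤ → ℤ → Set
InH N m x y = x * y ≡ + N [mod m ]

InL : ℕ → ℕ → ℕ → ℤ → Set
InL N m k z = ∃[ x ] ∃[ y ] (InH N m x y × z ≡ (+ k) * x + y [mod m ])

IsSquareMod : ℕ → ℤ → Set
IsSquareMod m z = ∃[ y ] z ≡ y * y [mod m ]

InS : ℕ → ℕ → ℕ → ℤ → Set
InS N m k x = IsSquareMod m (x * x - (+ 4) * (+ k) * (+ N))

{-# OPTIONS --safe #-}
module Submission where

open import Defs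
open import Data.Integer using (ℤ; +_; _+_; _-_; _*_; -_)
open import Data.Integer.Divisibility.Signed
  using (divides; ∣ᵤ⇒∣; ∣⇒∣ᵤ; ∣m∣n⇒∣m+n; ∣n⇒∣m*n; ∣m⇒∣-m)
  renaming (_∣_ to _∣ℤ_)
open import Data.Integer.Properties using (pos-*)
open import Data.Integer.Tactic.RingSolver using (solve-∀)
open import Data.Empty using (⊥-elim)
open import Data.Nat as ℕ using (ℕ; zero; suc)
open import Data.Nat.Divisibility using (_∣_; _∣0; ∣-refl)
  renaming (∣m∣n⇒∣m+n to ∣m∣n⇒∣m+n-ℕ)
open import Data.Nat.GCD using (gcd; gcd-GCD; module Bézout)
open import Data.Nat.Properties using (+-suc; *-comm)
open import Data.Product using (∃-syntax; _×_; _,_)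
open import Function using (_∘_)
open import Level using (0ℓ)
open import Relation.Binary.Bundles using (Setoid)
open import Relation.Binary.PropositionalEquality using (_≡_; refl; sym; trans; cong; subst)
import Relation.Binary.Reasoning.Setoid as SetoidReasoning
open import Relation.Nullary using (¬_)

-- If xy ≡ N then (kx + y)² − 4kN ≡ (kx − y)². Conversely, for odd m with
-- gcd(Nk, m) = 1 both 2 and k are units mod m; if z² − 4kN ≡ w², then
-- y = (z − w)/2 and x = k⁻¹(z + w)/2 give kx + y ≡ z and
-- kxy ≡ (z² − w²)/4 ≡ kN, hence xy ≡ N.

-- x ≡ y [mod m ] is a divisibility of absolute values, from which Agda cannot
-- infer x and y; all reasoning is done with this record, indexed by x and y.
record _≈_⟨mod_⟩ (x y : ℤ) (m : ℕ) : Set where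
  constructor ⟨_⟩
  field m∣x-y : + m ∣ℤ x - y

infix 4 _≈_⟨mod_⟩

module _ {m : ℕ} where

  ≡-mod⇒≈ : ∀ x y → x ≡ y [mod m ] → x ≈ y ⟨mod m ⟩
  ≡-mod⇒≈ _ _ p = ⟨ ∣ᵤ⇒∣ p ⟩

  ≈⇒≡-mod : ∀ {x y} → x ≈ y ⟨mod m ⟩ → x ≡ y [mod m ]
  ≈⇒≡-mod ⟨ p ⟩ = ∣⇒∣ᵤ p

  ≈-reflexive : ∀ {x y} → x ≡ y → x ≈ y ⟨mod m ⟩
  ≈-reflexive {x} refl = ⟨ divides (+ 0) (x-x≡0*m x (+ m)) ⟩
    where x-x≡0*m : ∀ x m → x - x ≡ + 0 * m
          x-x≡0*m = solve-∀

  ≈-refl : ∀ {x} → x ≈ x ⟨mod m ⟩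
  ≈-refl = ≈-reflexive refl

  ≈-sym : ∀ {x y} → x ≈ y ⟨mod m ⟩ → y ≈ x ⟨mod m ⟩
  ≈-sym {x} {y} ⟨ p ⟩ = ⟨ subst (+ m ∣ℤ_) (diff x y) (∣m⇒∣-m p) ⟩
    where diff : ∀ x y → - (x - y) ≡ y - x
          diff = solve-∀

  ≈-trans : ∀ {x y z} → x ≈ y ⟨mod m ⟩ → y ≈ z ⟨mod m ⟩ → x ≈ z ⟨mod m ⟩
  ≈-trans {x} {y} {z} ⟨ p ⟩ ⟨ q ⟩ = ⟨ subst (+ m ∣ℤ_) (diff x y z) (∣m∣n⇒∣m+n p q) ⟩
    where diff : ∀ x y z → (x - y) + (y - z) ≡ x - z
          diff = solve-∀

  +-cong : ∀ {x y u v} → x ≈ y ⟨mod m ⟩ → u ≈ v ⟨mod m ⟩ → x + u ≈ y + v ⟨mod m ⟩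
  +-cong {x} {y} {u} {v} ⟨ p ⟩ ⟨ q ⟩ = ⟨ subst (+ m ∣ℤ_) (diff x y u v) (∣m∣n⇒∣m+n p q) ⟩
    where diff : ∀ x y u v → (x - y) + (u - v) ≡ (x + u) - (y + v)
          diff = solve-∀

  +-congˡ : ∀ x {u v} → u ≈ v ⟨mod m ⟩ → x + u ≈ x + v ⟨mod m ⟩
  +-congˡ x = +-cong (≈-refl {x})

  +-congʳ : ∀ u {x y} → x ≈ y ⟨mod m ⟩ → x + u ≈ y + u ⟨mod m ⟩
  +-congʳ u p = +-cong p (≈-refl {u})

  -‿cong : ∀ {x y} → x ≈ y ⟨mod m ⟩ → - x ≈ - y ⟨mod m ⟩
  -‿cong {x} {y} ⟨ p ⟩ = ⟨ subst (+ m ∣ℤ_) (diff x y) (∣m⇒∣-m p) ⟩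
    where diff : ∀ x y → - (x - y) ≡ - x - - y
          diff = solve-∀

  *-cong : ∀ {x y u v} → x ≈ y ⟨mod m ⟩ → u ≈ v ⟨mod m ⟩ → x * u ≈ y * v ⟨mod m ⟩
  *-cong {x} {y} {u} {v} ⟨ p ⟩ ⟨ q ⟩ =
    ⟨ subst (+ m ∣ℤ_) (diff x y u v) (∣m∣n⇒∣m+n (∣n⇒∣m*n u p) (∣n⇒∣m*n y q)) ⟩
    where diff : ∀ x y u v → u * (x - y) + y * (u - v) ≡ x * u - y * v
          diff = solve-∀

  *-congˡ : ∀ x {u v} → u ≈ v ⟨mod m ⟩ → x * u ≈ x * v ⟨mod m ⟩
  *-congˡ x = *-cong (≈-refl {x})

  *-congʳ : ∀ u {x y} → x ≈ y ⟨mod m ⟩ → x * u ≈ y * u ⟨mod m ⟩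
  *-congʳ u p = *-cong p (≈-refl {u})

≈-setoid : ℕ → Setoid 0ℓ 0ℓ
≈-setoid m = record
  { Carrier = ℤ
  ; _≈_ = _≈_⟨mod m ⟩
  ; isEquivalence = record { refl = ≈-refl ; sym = ≈-sym ; trans = ≈-trans }
  }

InL⇒InS : ∀ N m k z → InL N m k z → InS N m k z
InL⇒InS N m k z (x , y , xy≡N , z≡kx+y) = K * x - y , ≈⇒≡-mod (begin
  z * z - + 4 * K * + N
    ≈⟨ +-cong (*-cong z≈kx+y z≈kx+y) (-‿cong (*-congˡ (+ 4 * K) (≈-sym (≡-mod⇒≈ _ _ xy≡N)))) ⟩
  (K * x + y) * (K * x + y) - + 4 * K * (x * y)
    ≡⟨ sum-square-identity K x y ⟩
  (K * x - y) * (K * x - y) ∎)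
  where
  K : ℤ
  K = + k
  z≈kx+y : z ≈ K * x + y ⟨mod m ⟩
  z≈kx+y = ≡-mod⇒≈ z (K * x + y) z≡kx+y
  sum-square-identity : ∀ K x y → (K * x + y) * (K * x + y) - + 4 * K * (x * y) ≡ (K * x - y) * (K * x - y)
  sum-square-identity = solve-∀
  open SetoidReasoning (≈-setoid m)

m≈0 : ∀ {m} → + m ≈ + 0 ⟨mod m ⟩
m≈0 {m} = ⟨ divides (+ 1) (m-0≡1*m (+ m)) ⟩
  where m-0≡1*m : ∀ m → m - + 0 ≡ + 1 * m
        m-0≡1*m = solve-∀

gcd≡1⇒invertible : ∀ a m → gcd a m ≡ 1 → ∃[ b ] + a * b ≈ + 1 ⟨mod m ⟩
gcd≡1⇒invertible a m gcd≡1
  with subst (λ d → Bézout.Identity d a m) gcd≡1 (Bézout.identity (gcd-GCD a m))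
... | Bézout.+- x y 1+ym≡xa = + x , (begin
  + a * + x            ≡⟨ sym (pos-* a x) ⟩
  + (a ℕ.* x)          ≡⟨ cong +_ (trans (*-comm a x) (sym 1+ym≡xa)) ⟩
  + 1 + + (y ℕ.* m)    ≡⟨ cong (λ t → + 1 + t) (pos-* y m) ⟩
  + 1 + + y * + m      ≈⟨ +-congˡ (+ 1) (*-congˡ (+ y) m≈0) ⟩
  + 1 + + y * + 0      ≡⟨ 1+y*0≡1 (+ y) ⟩
  + 1                  ∎)
  where open SetoidReasoning (≈-setoid m)
        1+y*0≡1 : ∀ y → + 1 + y * + 0 ≡ + 1
        1+y*0≡1 = solve-∀
... | Bézout.-+ x y 1+xa≡ym = - + x , (begin
  + a * - + x                ≡⟨ a*-x≡1-[1+xa] (+ a) (+ x) ⟩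
  + 1 - (+ 1 + + x * + a)    ≡⟨ cong (λ t → + 1 - (+ 1 + t)) (sym (pos-* x a)) ⟩
  + 1 - + (1 ℕ.+ x ℕ.* a)    ≡⟨ cong (λ t → + 1 - + t) 1+xa≡ym ⟩
  + 1 - + (y ℕ.* m)          ≡⟨ cong (λ t → + 1 - t) (pos-* y m) ⟩
  + 1 - + y * + m            ≈⟨ +-congˡ (+ 1) (-‿cong (*-congˡ (+ y) m≈0)) ⟩
  + 1 - + y * + 0            ≡⟨ 1-y*0≡1 (+ y) ⟩
  + 1                        ∎)
  where open SetoidReasoning (≈-setoid m)
        a*-x≡1-[1+xa] : ∀ a x → a * - x ≡ + 1 - (+ 1 + x * a)
        a*-x≡1-[1+xa] = solve-∀
        1-y*0≡1 : ∀ y → + 1 - y * + 0 ≡ + 1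
        1-y*0≡1 = solve-∀

odd⇒≡1+2t : ∀ m → ¬ 2 ∣ m → ∃[ t ] m ≡ suc (t ℕ.+ t)
odd⇒≡1+2t zero                2∤m = ⊥-elim (2∤m (2 ∣0))
odd⇒≡1+2t (suc zero)          _   = 0 , refl
odd⇒≡1+2t (suc (suc m)) 2∤m+2 with odd⇒≡1+2t m (2∤m+2 ∘ ∣m∣n⇒∣m+n-ℕ ∣-refl)
... | t , refl = suc t , cong (suc ∘ suc) (sym (+-suc t t))

odd⇒2-invertible : ∀ m → ¬ 2 ∣ m → ∃[ h ] + 2 * h ≈ + 1 ⟨mod m ⟩
odd⇒2-invertible m 2∤m with odd⇒≡1+2t m 2∤m
... | t , refl = + suc t , ⟨ divides (+ 1) (2[1+t]-1≡1+2t (+ t)) ⟩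
  where 2[1+t]-1≡1+2t : ∀ t → + 2 * (+ 1 + t) - + 1 ≡ + 1 * (+ 1 + (t + t))
        2[1+t]-1≡1+2t = solve-∀

gcd[n*k,m]≡1⇒k-invertible : ∀ n k m → gcd (n ℕ.* k) m ≡ 1 → ∃[ u ] + k * u ≈ + 1 ⟨mod m ⟩
gcd[n*k,m]≡1⇒k-invertible n k m gcd≡1 with gcd≡1⇒invertible (n ℕ.* k) m gcd≡1
... | b , nkb≈1 = + n * b , (begin
  + k * (+ n * b)        ≡⟨ k*[n*b]≡n*k*b (+ k) (+ n) b ⟩
  + n * + k * b          ≡⟨ cong (_* b) (pos-* n k) ⟨
  + (n ℕ.* k) * b        ≈⟨ nkb≈1 ⟩
  + 1                    ∎)
  where open SetoidReasoning (≈-setoid m)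
        k*[n*b]≡n*k*b : ∀ k n b → k * (n * b) ≡ n * k * b
        k*[n*b]≡n*k*b = solve-∀

InS⇒InL : ∀ N m k {u h} → + k * u ≈ + 1 ⟨mod m ⟩ → + 2 * h ≈ + 1 ⟨mod m ⟩ →
          ∀ z → InS N m k z → InL N m k z
InS⇒InL N m k {u} {h} ku≈1 2h≈1 z (w , disc≡w²) = x , y , ≈⇒≡-mod xy≈N , ≈⇒≡-mod (≈-sym kx+y≈z)
  where
  K 4kN x y : ℤ
  K = + k
  4kN = + 4 * K * + N
  x = u * (h * (z + w))
  y = h * (z - w)
  open SetoidReasoning (≈-setoid m)

  z²-w²≈4kN : z * z - w * w ≈ 4kN ⟨mod m ⟩
  z²-w²≈4kN = begin
    z * z - w * w            ≈⟨ +-congˡ (z * z) (-‿cong (≈-sym (≡-mod⇒≈ (z * z - 4kN) (w * w) disc≡w²))) ⟩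
    z * z - (z * z - 4kN)    ≡⟨ a-[a-c]≡c (z * z) 4kN ⟩
    4kN                      ∎
    where a-[a-c]≡c : ∀ a c → a - (a - c) ≡ c
          a-[a-c]≡c = solve-∀

  xy≈N : x * y ≈ + N ⟨mod m ⟩
  xy≈N = begin
    x * y                                ≡⟨ xy≡uhh[z²-w²] u h z w ⟩
    u * h * h * (z * z - w * w)          ≈⟨ *-congˡ (u * h * h) z²-w²≈4kN ⟩
    u * h * h * 4kN                      ≡⟨ uhh4kN≡ku*N*[2h]² K (+ N) u h ⟩
    K * u * + N * (+ 2 * h * (+ 2 * h))  ≈⟨ *-cong (*-congʳ (+ N) ku≈1) (*-cong 2h≈1 2h≈1) ⟩
    + 1 * + N * (+ 1 * + 1)              ≡⟨ 1*N*[1*1]≡N (+ N) ⟩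
    + N                                  ∎
    where xy≡uhh[z²-w²] : ∀ u h z w → u * (h * (z + w)) * (h * (z - w)) ≡ u * h * h * (z * z - w * w)
          xy≡uhh[z²-w²] = solve-∀
          uhh4kN≡ku*N*[2h]² : ∀ K N u h → u * h * h * (+ 4 * K * N) ≡ K * u * N * (+ 2 * h * (+ 2 * h))
          uhh4kN≡ku*N*[2h]² = solve-∀
          1*N*[1*1]≡N : ∀ N → + 1 * N * (+ 1 * + 1) ≡ N
          1*N*[1*1]≡N = solve-∀

  kx+y≈z : K * x + y ≈ z ⟨mod m ⟩
  kx+y≈z = begin
    K * x + y                       ≡⟨ k[uv]≡[ku]v K u (h * (z + w)) y ⟩
    K * u * (h * (z + w)) + y       ≈⟨ +-congʳ y (*-congʳ (h * (z + w)) ku≈1) ⟩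
    + 1 * (h * (z + w)) + y         ≡⟨ h[z+w]+h[z-w]≡2hz h z w ⟩
    + 2 * h * z                     ≈⟨ *-congʳ z 2h≈1 ⟩
    + 1 * z                         ≡⟨ 1*z≡z z ⟩
    z                               ∎
    where k[uv]≡[ku]v : ∀ k u v y → k * (u * v) + y ≡ k * u * v + y
          k[uv]≡[ku]v = solve-∀
          h[z+w]+h[z-w]≡2hz : ∀ h z w → + 1 * (h * (z + w)) + h * (z - w) ≡ + 2 * h * z
          h[z+w]+h[z-w]≡2hz = solve-∀
          1*z≡z : ∀ z → + 1 * z ≡ z
          1*z≡z = solve-∀

lemma4p2 : (N m k : ℕ) → gcd (N ℕ.* k) m ≡ 1 →
    ((z : ℤ) → InL N m k z → InS N m k z)
    × (¬ (2 ∣ m) → (z : ℤ) → InS N m k z → InL N m k z)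
lemma4p2 N m k gcd≡1 = InL⇒InS N m k , S⊆L
  where
  S⊆L : ¬ (2 ∣ m) → (z : ℤ) → InS N m k z → InL N m k z
  S⊆L 2∤m =
    let (_ , ku≈1) = gcd[n*k,m]≡1⇒k-invertible N k m gcd≡1
        (_ , 2h≈1) = odd⇒2-invertible m 2∤m
    in  InS⇒InL N m k ku≈1 2h≈1
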